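{- There exists an infinite family of strings $w$, with lengths $n=|w|$ unbounded over the family, such that $r_{\$}(w^R)-r_{\$}(w)=n/5$ for every $w$ in the family (in particular $r_{\$}(w^R)-r_{\$}(w)=\Theta(n)$).
   Context: Strings are over a finite totally ordered alphabet (which may depend on the string); strings are compared lexicographically. For $w=w[1]\cdots w[n]$, $w^R=w[n]\cdots w[1]$. The Burrows–Wheeler transform ${\tt BWT}(s)$ of a string $s$ is obtained by sorting the multiset of all rotations $s[i\ldots |s|]s[1\ldots i-1]$ of $s$ lexicographically and concatenating their last characters. The number of runs of a string is the number of maximal blocks of consecutive equal symbols. $r_{\$}(w)$ denotes the number of runs of ${\tt BWT}(w\$)$, where $\$$ is a fresh symbol not occurring in $w$ and smaller than every symbol of the alphabet. -}

module Defs where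

open import Data.Nat using (ℕ; zero; suc; _+_; _<ᵇ_; _≡ᵇ_)
open import Data.Bool using (Bool; true; false; if_then_else_; _∧_; _∨_)
open import Data.List using (List; []; _∷_; _++_; drop; take; map; length; upTo)

-- Strings are lists of naturals; the alphabet is ℕ with its usual order
-- (a string uses only finitely many symbols, so its alphabet is finite).

lex≤ : List ℕ → List ℕ → Bool
lex≤ [] _ = true
lex≤ (x ∷ xs) [] = false
lex≤ (x ∷ xs) (y ∷ ys) = (x <ᵇ y) ∨ ((x ≡ᵇ y) ∧ lex≤ xs ys)

insert : List ℕ → List (List ℕ) → List (List ℕ)
insert u [] = u ∷ []
insert u (v ∷ vs) = if lex≤ u v then u ∷ v ∷ vs else v ∷ insert u vs

sortLex : List (List ℕ) → List (List ℕ)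
sortLex [] = []
sortLex (u ∷ us) = insert u (sortLex us)

rotations : List ℕ → List (List ℕ)
rotations s = map (λ i → drop i s ++ take i s) (upTo (length s))

-- last character (rotations are non-empty, so the default is never used)
lastChar : List ℕ → ℕ
lastChar [] = 0
lastChar (x ∷ []) = x
lastChar (x ∷ y ∷ ys) = lastChar (y ∷ ys)

BWT : List ℕ → List ℕ
BWT s = map lastChar (sortLex (rotations s))

runsFrom : ℕ → List ℕ → ℕ
runsFrom p [] = 0
runsFrom p (x ∷ xs) = if p ≡ᵇ x then runsFrom x xs else suc (runsFrom x xs)

runs : List ℕ → ℕ
runs [] = 0
runs (x ∷ xs) = suc (runsFrom x xs)

-- w$ : shift every symbol up by one and use 0 as the fresh smallest symbol $
dollar : List ℕ → List ℕ
dollar w = map suc w ++ (0 ∷ [])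

r$ : List ℕ → ℕ
r$ w = runs (BWT (dollar w))

{-# OPTIONS --safe #-}
module Submission where

-- The witness is w = ∏_{j<k} (2j+1)⁴ (2j), so |w| = 5k; after the shift made by dollar its blocks read
-- b⁴a with a = 2j+1 < b = 2j+2.  Each block uses symbols above all earlier blocks, so the sorted rotations
-- of w$ and of wᴿ$ come in groups, one per block, ordered as the blocks, and inside a group the order is
-- decided within the block.  The group of b⁴a contributes b⁴c to BWT(w$), c the symbol before the block:
-- two runs.  The group of ab⁴ in wᴿ contributes p b³ a, p the symbol before that block: three runs.
-- Hence r$(w) = 2k+1 and r$(wᴿ) = 3k+1.

open import Defs
open import Data.Nat using (ℕ; zero; suc; _+_; _*_; _≥_; _≤_; _<_; z≤n; s≤s; z<s; _≡ᵇ_)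
open import Data.Nat.Properties
  using ( ≤-refl; <-trans; ≤-<-trans; <-≤-trans; m<n⇒m<1+n; n≤1+n; m≤n+m; m<n+m; m≤m*n
        ; <⇒≢; >⇒≢; +-comm; ≡ᵇ⇒≡)
open import Data.Bool using (true; false)
open import Data.List using (List; []; _∷_; _++_; map; reverse; length; drop; take; applyUpTo)
open import Data.List.Properties using (++-assoc; ++-identityʳ; map-++; length-++; reverse-++; unfold-reverse; map-upTo)
open import Data.List.Relation.Unary.All as All using (All; []; _∷_)
open import Data.List.Relation.Unary.All.Properties using (++⁺; map⁺)
open import Data.List.Relation.Unary.AllPairs using (AllPairs; []; _∷_)
open import Data.List.Relation.Unary.Any.Properties using (reverse⁻)
open import Data.Product using (Σ; _×_; _,_)
open import Data.Sum using (_⊎_; inj₁; inj₂)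
open import Data.Empty using (⊥; ⊥-elim)
open import Function using (_∘_)
open import Data.Nat.Tactic.RingSolver using (solve-∀)
open import Relation.Binary.PropositionalEquality
  using (_≡_; _≢_; refl; sym; trans; cong; cong₂; subst; ≢-sym; module ≡-Reasoning)

open ≡-Reasoning

private
  variable
    P : ℕ → Set
    p t x y : ℕ
    u xs ys C G H : List ℕ
    us vs : List (List ℕ)

infix 4 _>lex_

data _>lex_ : List ℕ → List ℕ → Set where
  head> : ∀ {x y xs ys} → y < x → (x ∷ xs) >lex (y ∷ ys)
  ∷>    : ∀ {x xs ys} → xs >lex ys → (x ∷ xs) >lex (x ∷ ys)

lex≤-∷ : ∀ x xs ys → lex≤ (x ∷ xs) (x ∷ ys) ≡ lex≤ xs ys
lex≤-∷ zero    xs ys = refl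
lex≤-∷ (suc x) xs ys = lex≤-∷ x xs ys

lex≤-< : ∀ {x y} xs ys → x < y → lex≤ (x ∷ xs) (y ∷ ys) ≡ true
lex≤-< {zero}  {suc y} xs ys _         = refl
lex≤-< {suc x} {suc y} xs ys (s≤s x<y) = lex≤-< xs ys x<y

lex≤-> : ∀ {x y} xs ys → y < x → lex≤ (x ∷ xs) (y ∷ ys) ≡ false
lex≤-> {suc x} {zero}  xs ys _         = refl
lex≤-> {suc x} {suc y} xs ys (s≤s y<x) = lex≤-> xs ys y<x

>lex⇒lex≰ : xs >lex ys → lex≤ xs ys ≡ false
>lex⇒lex≰ (head> {xs = xs} {ys = ys} y<x) = lex≤-> xs ys y<x
>lex⇒lex≰ (∷> {x} {xs} {ys} xs>ys)      = trans (lex≤-∷ x xs ys) (>lex⇒lex≰ xs>ys)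

>lex⇒lex≤ : xs >lex ys → lex≤ ys xs ≡ true
>lex⇒lex≤ (head> {xs = xs} {ys = ys} y<x) = lex≤-< ys xs y<x
>lex⇒lex≤ (∷> {x} {xs} {ys} xs>ys)      = trans (lex≤-∷ x ys xs) (>lex⇒lex≤ xs>ys)

insert-++ : ∀ us → All (_>lex u) vs → insert u (us ++ vs) ≡ insert u us ++ vs
insert-++ []       []        = refl
insert-++ []       (v>u ∷ _) rewrite >lex⇒lex≤ v>u = refl
insert-++ {u} (w ∷ us) vs>u with lex≤ u w
... | true  = refl
... | false = cong (w ∷_) (insert-++ us vs>u)

insert-++-skip : ∀ us → All (u >lex_) us → insert u (us ++ vs) ≡ us ++ insert u vs
insert-++-skip []       []           = refl
insert-++-skip (w ∷ us) (u>w ∷ u>us) rewrite >lex⇒lex≰ u>w = cong (w ∷_) (insert-++-skip us u>us)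

All-insert : ∀ {Q : List ℕ → Set} → Q u → All Q us → All Q (insert u us)
All-insert qu [] = qu ∷ []
All-insert {u} {us = w ∷ _} qu (qw ∷ qus) with lex≤ u w
... | true  = qu ∷ qw ∷ qus
... | false = qw ∷ All-insert qu qus

All-sortLex : ∀ {Q : List ℕ → Set} → All Q us → All Q (sortLex us)
All-sortLex []         = []
All-sortLex (qu ∷ qus) = All-insert qu (All-sortLex qus)

sortLex-∷-least : All (_>lex u) us → sortLex (u ∷ us) ≡ u ∷ sortLex us
sortLex-∷-least us>u = insert-++ [] (All-sortLex us>u)

sortLex-++ : All (λ u → All (_>lex u) vs) us → sortLex (us ++ vs) ≡ sortLex us ++ sortLex vs
sortLex-++ [] = refl
sortLex-++ {vs} {u ∷ us} (vs>u ∷ vs>us) = begin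
  insert u (sortLex (us ++ vs))        ≡⟨ cong (insert u) (sortLex-++ vs>us) ⟩
  insert u (sortLex us ++ sortLex vs)  ≡⟨ insert-++ (sortLex us) (All-sortLex vs>u) ⟩
  insert u (sortLex us) ++ sortLex vs  ∎

sortLex-++-flip : All (λ u → All (u >lex_) vs) us → sortLex (us ++ vs) ≡ sortLex vs ++ sortLex us
sortLex-++-flip {vs} [] = sym (++-identityʳ (sortLex vs))
sortLex-++-flip {vs} {u ∷ us} (u>vs ∷ us>vs) = begin
  insert u (sortLex (us ++ vs))        ≡⟨ cong (insert u) (sortLex-++-flip us>vs) ⟩
  insert u (sortLex vs ++ sortLex us)  ≡⟨ insert-++-skip (sortLex vs) (All-sortLex u>vs) ⟩
  sortLex vs ++ insert u (sortLex us)  ∎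

sortLex-descending : AllPairs _>lex_ us → sortLex us ≡ reverse us
sortLex-descending [] = refl
sortLex-descending {u ∷ us} (u>us ∷ descending) = begin
  insert u (sortLex us)        ≡⟨ cong (insert u) (sym (++-identityʳ (sortLex us))) ⟩
  insert u (sortLex us ++ [])  ≡⟨ insert-++-skip (sortLex us) (All-sortLex u>us) ⟩
  sortLex us ++ u ∷ []         ≡⟨ cong (_++ u ∷ []) (sortLex-descending descending) ⟩
  reverse us ++ u ∷ []         ≡⟨ sym (unfold-reverse u us) ⟩
  reverse (u ∷ us)             ∎

All-reverse : All P xs → All P (reverse xs)
All-reverse pxs = All.tabulate (All.lookup pxs ∘ reverse⁻)

Head : (ℕ → Set) → List ℕ → Set
Head P []      = ⊥
Head P (x ∷ _) = P x

Head-++ : All P xs → P y → Head P (xs ++ y ∷ ys)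
Head-++ []       py = py
Head-++ (px ∷ _) _  = px

>lex-Head : ∀ {t} xs ys → Head (t ≤_) xs → Head (_< t) ys → xs >lex ys
>lex-Head (_ ∷ _) (_ ∷ _) t≤x y<t = head> (<-≤-trans y<t t≤x)

-- rotationsIn G C: the rotations of the cyclic word G ++ C that start inside G, in order.
rotationsIn : List ℕ → List ℕ → List (List ℕ)
rotationsIn []      C = []
rotationsIn (g ∷ G) C = (g ∷ G ++ C) ∷ rotationsIn G (C ++ g ∷ [])

applyUpTo≡rotationsIn : ∀ G C (f : ℕ → List ℕ) → (∀ i → f i ≡ drop i G ++ C ++ take i G) →
                        applyUpTo f (length G) ≡ rotationsIn G C
applyUpTo≡rotationsIn []      C f f≗ = refl
applyUpTo≡rotationsIn (g ∷ G) C f f≗ = cong₂ _∷_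
  (trans (f≗ 0) (cong (λ D → g ∷ G ++ D) (++-identityʳ C)))
  (applyUpTo≡rotationsIn G (C ++ g ∷ []) (f ∘ suc)
    (λ i → trans (f≗ (suc i)) (cong (drop i G ++_) (sym (++-assoc C (g ∷ []) (take i G))))))

rotations≡rotationsIn : ∀ w → rotations w ≡ rotationsIn w []
rotations≡rotationsIn w = trans (map-upTo _ (length w)) (applyUpTo≡rotationsIn w [] _ (λ _ → refl))

rotationsIn-++ : ∀ G H C → rotationsIn (G ++ H) C ≡ rotationsIn G (H ++ C) ++ rotationsIn H (C ++ G)
rotationsIn-++ []      H C rewrite ++-identityʳ C = refl
rotationsIn-++ (g ∷ G) H C
  rewrite rotationsIn-++ G H (C ++ g ∷ []) | ++-assoc C (g ∷ []) G
        | ++-assoc G H C | ++-assoc H C (g ∷ []) = refl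

All-Head-rotationsIn : All P G → All (Head P) (rotationsIn G C)
All-Head-rotationsIn []        = []
All-Head-rotationsIn (pg ∷ pG) = pg ∷ All-Head-rotationsIn pG

sortLex-rotationsIn-++ : All (_< t) G → All (t ≤_) H →
  sortLex (rotationsIn (G ++ H) C) ≡ sortLex (rotationsIn G (H ++ C)) ++ sortLex (rotationsIn H (C ++ G))
sortLex-rotationsIn-++ {G = G} {H = H} {C = C} G<t t≤H = trans (cong sortLex (rotationsIn-++ G H C))
  (sortLex-++ (All.map (λ u<t → All.map (λ t≤v → >lex-Head _ _ t≤v u<t) (All-Head-rotationsIn t≤H))
                       (All-Head-rotationsIn G<t)))

sortLex-rotationsIn-++-flip : All (t ≤_) G → All (_< t) H →
  sortLex (rotationsIn (G ++ H) C) ≡ sortLex (rotationsIn H (C ++ G)) ++ sortLex (rotationsIn G (H ++ C))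
sortLex-rotationsIn-++-flip {G = G} {H = H} {C = C} t≤G H<t = trans (cong sortLex (rotationsIn-++ G H C))
  (sortLex-++-flip (All.map (λ t≤u → All.map (>lex-Head _ _ t≤u) (All-Head-rotationsIn H<t))
                            (All-Head-rotationsIn t≤G)))

BWT-dollar : ∀ w →
  BWT (dollar w) ≡ lastChar (0 ∷ map suc w) ∷ map lastChar (sortLex (rotationsIn (map suc w) (0 ∷ [])))
BWT-dollar w = cong (map lastChar) (begin
  sortLex (rotations (map suc w ++ 0 ∷ []))       ≡⟨ cong sortLex (rotations≡rotationsIn (map suc w ++ 0 ∷ [])) ⟩
  sortLex (rotationsIn (map suc w ++ 0 ∷ []) [])  ≡⟨ sortLex-rotationsIn-++-flip
                                                       (map⁺ (All.universal (λ _ → s≤s z≤n) w)) (z<s ∷ []) ⟩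
  (0 ∷ map suc w) ∷ sortLex (rotationsIn (map suc w) (0 ∷ [])) ∎)

lastChar-++ : ∀ x xs ys → lastChar (x ∷ xs ++ ys) ≡ lastChar (lastChar (x ∷ xs) ∷ ys)
lastChar-++ x []       ys = refl
lastChar-++ x (y ∷ xs) ys = lastChar-++ y xs ys

lastChar-All : All P (x ∷ xs) → P (lastChar (x ∷ xs))
lastChar-All (px ∷ [])          = px
lastChar-All (_ ∷ pys@(_ ∷ _)) = lastChar-All pys

-- Each rotation ends with the symbol cyclically preceding its start.
lastChar-rotationsIn : ∀ g G C →
  map lastChar (rotationsIn (g ∷ G) C) ≡ lastChar (g ∷ G ++ C) ∷ take (length G) (g ∷ G)
lastChar-rotationsIn g []       C = refl
lastChar-rotationsIn g (h ∷ G) C = cong (lastChar (g ∷ h ∷ G ++ C) ∷_)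
  (trans (lastChar-rotationsIn h G (C ++ g ∷ []))
         (cong (_∷ take (length G) (h ∷ G)) (trans (lastChar-++ h G (C ++ g ∷ [])) (lastChar-++ _ C (g ∷ [])))))

≡ᵇ-refl : ∀ n → (n ≡ᵇ n) ≡ true
≡ᵇ-refl zero    = refl
≡ᵇ-refl (suc n) = ≡ᵇ-refl n

≢⇒≡ᵇ-false : x ≢ y → (x ≡ᵇ y) ≡ false
≢⇒≡ᵇ-false {x} {y} x≢y with x ≡ᵇ y | ≡ᵇ⇒≡ x y
... | false | _   = refl
... | true  | x≡y = ⊥-elim (x≢y (x≡y _))

runsFrom-++ : ∀ p xs ys → runsFrom p (xs ++ ys) ≡ runsFrom p xs + runsFrom (lastChar (p ∷ xs)) ys
runsFrom-++ p []       ys = refl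
runsFrom-++ p (x ∷ xs) ys with p ≡ᵇ x
... | true  = runsFrom-++ x xs ys
... | false = cong suc (runsFrom-++ x xs ys)

block : ℕ → ℕ → List ℕ
block a b = b ∷ b ∷ b ∷ b ∷ a ∷ []

reversedBlockBWT : ℕ → ℕ → ℕ → List ℕ
reversedBlockBWT p a b = p ∷ b ∷ b ∷ b ∷ a ∷ []

sortedBlock : ∀ {a b} → a < b → ∀ C →
  map lastChar (sortLex (rotationsIn (block a b) C)) ≡ block (lastChar (a ∷ C)) b
sortedBlock {a} {b} a<b C = begin
  map lastChar (sortLex (rotationsIn (block a b) C))
    ≡⟨ cong (map lastChar) (sortLex-descending descending) ⟩
  map lastChar (reverse (rotationsIn (block a b) C))
    ≡⟨ cong reverse (lastChar-rotationsIn b (b ∷ b ∷ b ∷ a ∷ []) C) ⟩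
  block (lastChar (a ∷ C)) b ∎
  where
  -- bⁱa… and bʲa… with i > j share bʲ and then compare b > a.
  descending : AllPairs _>lex_ (rotationsIn (block a b) C)
  descending = (∷> (∷> (∷> (head> a<b))) ∷ ∷> (∷> (head> a<b)) ∷ ∷> (head> a<b) ∷ head> a<b ∷ [])
             ∷ (∷> (∷> (head> a<b)) ∷ ∷> (head> a<b) ∷ head> a<b ∷ [])
             ∷ (∷> (head> a<b) ∷ head> a<b ∷ [])
             ∷ (head> a<b ∷ [])
             ∷ [] ∷ []

sortedReversedBlock : ∀ {a b C} → a < b → Head (_< b) C →
  map lastChar (sortLex (rotationsIn (reverse (block a b)) C)) ≡ reversedBlockBWT (lastChar (b ∷ C)) a b
sortedReversedBlock {a} {b} {q ∷ C} a<b q<b = begin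
  map lastChar (sortLex (rotationsIn (a ∷ bbbb) (q ∷ C)))
    ≡⟨ cong (map lastChar) (sortLex-∷-least (head> a<b ∷ head> a<b ∷ head> a<b ∷ head> a<b ∷ [])) ⟩
  lastChar (q ∷ C) ∷ map lastChar (sortLex (rotationsIn bbbb (q ∷ C ++ a ∷ [])))
    ≡⟨ cong (λ r → lastChar (q ∷ C) ∷ map lastChar r) (sortLex-descending descending) ⟩
  lastChar (q ∷ C) ∷ map lastChar (reverse (rotationsIn bbbb (q ∷ C ++ a ∷ [])))
    ≡⟨ cong (λ l → lastChar (q ∷ C) ∷ reverse l)
            (trans (lastChar-rotationsIn b (b ∷ b ∷ b ∷ []) (q ∷ C ++ a ∷ []))
                   (cong (_∷ b ∷ b ∷ b ∷ []) (lastChar-++ q C (a ∷ [])))) ⟩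
  reversedBlockBWT (lastChar (q ∷ C)) a b ∎
  where
  -- The rotation ab⁴q… is least since a < b; the others bⁱq… decrease with i since q < b.
  bbbb = b ∷ b ∷ b ∷ b ∷ []
  descending : AllPairs _>lex_ (rotationsIn bbbb (q ∷ C ++ a ∷ []))
  descending = (∷> (∷> (∷> (head> q<b))) ∷ ∷> (∷> (head> q<b)) ∷ ∷> (head> q<b) ∷ [])
             ∷ (∷> (∷> (head> q<b)) ∷ ∷> (head> q<b) ∷ [])
             ∷ (∷> (head> q<b) ∷ [])
             ∷ [] ∷ []

family : ℕ → List ℕ
family zero    = []
family (suc k) = family k ++ block (k * 2) (suc (k * 2))

length-family : ∀ k → length (family k) ≡ k * 5
length-family zero    = refl
length-family (suc k) = trans (length-++ (family k)) (trans (cong (_+ 5) (length-family k)) (+-comm (k * 5) 5))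

family-bound : ∀ k → All (_< k * 2) (family k)
family-bound zero    = []
family-bound (suc k) = ++⁺ (All.map (λ x<2k → <-≤-trans x<2k (m≤n+m (k * 2) 2)) (family-bound k))
                           (≤-refl ∷ ≤-refl ∷ ≤-refl ∷ ≤-refl ∷ n≤1+n _ ∷ [])

shifted-family-bound : ∀ k → All (_< suc (k * 2)) (map suc (family k))
shifted-family-bound k = map⁺ (All.map s≤s (family-bound k))

shifted-reverse-bound : ∀ k → All (_< suc (k * 2)) (map suc (reverse (family k)))
shifted-reverse-bound k = map⁺ (All.map s≤s (All-reverse (family-bound k)))

shifted-family-suc : ∀ k → map suc (family (suc k)) ≡ map suc (family k) ++ block (suc (k * 2)) (suc k * 2)
shifted-family-suc k = map-++ suc (family k) (block (k * 2) (suc (k * 2)))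

shifted-reverse-suc : ∀ k →
  map suc (reverse (family (suc k))) ≡ reverse (block (suc (k * 2)) (suc k * 2)) ++ map suc (reverse (family k))
shifted-reverse-suc k = trans (cong (map suc) (reverse-++ (family k) (block (k * 2) (suc (k * 2)))))
                              (map-++ suc (reverse (block (k * 2) (suc (k * 2)))) (reverse (family k)))

lastChar-shifted-family : ∀ k x → lastChar (x ∷ map suc (family (suc k))) ≡ suc (k * 2)
lastChar-shifted-family k x = trans (cong (λ w → lastChar (x ∷ w)) (shifted-family-suc k))
                                    (lastChar-++ x (map suc (family k)) _)

lastChar-shifted-reverse : ∀ k x → lastChar (x ∷ map suc (reverse (family (suc k)))) ≡ 2
lastChar-shifted-reverse zero    x = refl
lastChar-shifted-reverse (suc k) x = begin
  lastChar (x ∷ map suc (reverse (family (suc (suc k)))))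
    ≡⟨ cong (λ w → lastChar (x ∷ w)) (shifted-reverse-suc (suc k)) ⟩
  lastChar (x ∷ Bᴿ ++ R)          ≡⟨ lastChar-++ x Bᴿ R ⟩
  lastChar (suc (suc k) * 2 ∷ R)  ≡⟨ lastChar-shifted-reverse k _ ⟩
  2                               ∎
  where
  R = map suc (reverse (family (suc k)))
  Bᴿ = reverse (block (suc (suc k * 2)) (suc (suc k) * 2))

forwardBWT : ℕ → List ℕ
forwardBWT zero    = []
forwardBWT (suc k) = forwardBWT k ++ block (lastChar (0 ∷ map suc (family k))) (suc k * 2)

reverseBWT : ℕ → ℕ → List ℕ
reverseBWT zero    p = []
reverseBWT (suc k) p = reverseBWT k (suc k * 2) ++ reversedBlockBWT p (suc (k * 2)) (suc k * 2)

sortedForward : ∀ k C → map lastChar (sortLex (rotationsIn (map suc (family k)) (C ++ 0 ∷ []))) ≡ forwardBWT k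
sortedForward zero    C = refl
sortedForward (suc k) C = begin
  map lastChar (sortLex (rotationsIn (map suc (family (suc k))) C₀))
    ≡⟨ cong (λ w → map lastChar (sortLex (rotationsIn w C₀))) (shifted-family-suc k) ⟩
  map lastChar (sortLex (rotationsIn (S ++ B) C₀))
    ≡⟨ cong (map lastChar) (sortLex-rotationsIn-++
                              (shifted-family-bound k) (n≤1+n _ ∷ n≤1+n _ ∷ n≤1+n _ ∷ n≤1+n _ ∷ ≤-refl ∷ [])) ⟩
  map lastChar (sortLex (rotationsIn S (B ++ C₀)) ++ sortLex (rotationsIn B (C₀ ++ S)))
    ≡⟨ map-++ lastChar (sortLex (rotationsIn S (B ++ C₀))) _ ⟩
  map lastChar (sortLex (rotationsIn S (B ++ C₀))) ++ map lastChar (sortLex (rotationsIn B (C₀ ++ S)))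
    ≡⟨ cong₂ _++_ (sortedForward k (B ++ C)) (sortedBlock ≤-refl (C₀ ++ S)) ⟩
  forwardBWT k ++ block (lastChar (a ∷ C₀ ++ S)) b
    ≡⟨ cong (λ c → forwardBWT k ++ block c b)
            (trans (lastChar-++ a C₀ S) (cong (λ z → lastChar (z ∷ S)) (lastChar-++ a C (0 ∷ [])))) ⟩
  forwardBWT (suc k) ∎
  where
  a = suc (k * 2)
  b = suc k * 2
  S = map suc (family k)
  B = block a b
  C₀ = C ++ 0 ∷ []

sortedReverse : ∀ k C →
  map lastChar (sortLex (rotationsIn (map suc (reverse (family k))) (0 ∷ C))) ≡ reverseBWT k (lastChar (0 ∷ C))
sortedReverse zero    C = refl
sortedReverse (suc k) C = begin
  map lastChar (sortLex (rotationsIn (map suc (reverse (family (suc k)))) (0 ∷ C)))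
    ≡⟨ cong (λ w → map lastChar (sortLex (rotationsIn w (0 ∷ C)))) (shifted-reverse-suc k) ⟩
  map lastChar (sortLex (rotationsIn (Bᴿ ++ R) (0 ∷ C)))
    ≡⟨ cong (map lastChar) (sortLex-rotationsIn-++-flip
                              (≤-refl ∷ n≤1+n _ ∷ n≤1+n _ ∷ n≤1+n _ ∷ n≤1+n _ ∷ []) (shifted-reverse-bound k)) ⟩
  map lastChar (sortLex (rotationsIn R (0 ∷ C ++ Bᴿ)) ++ sortLex (rotationsIn Bᴿ (R ++ 0 ∷ C)))
    ≡⟨ map-++ lastChar (sortLex (rotationsIn R (0 ∷ C ++ Bᴿ))) _ ⟩
  map lastChar (sortLex (rotationsIn R (0 ∷ C ++ Bᴿ))) ++ map lastChar (sortLex (rotationsIn Bᴿ (R ++ 0 ∷ C)))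
    ≡⟨ cong₂ _++_ (sortedReverse k (C ++ Bᴿ))
                  (sortedReversedBlock ≤-refl (Head-++ (All.map m<n⇒m<1+n (shifted-reverse-bound k)) z<s)) ⟩
  reverseBWT k (lastChar (0 ∷ C ++ Bᴿ)) ++ reversedBlockBWT (lastChar (b ∷ R ++ 0 ∷ C)) a b
    ≡⟨ cong₂ (λ p p′ → reverseBWT k p ++ reversedBlockBWT p′ a b)
             (lastChar-++ 0 C Bᴿ) (lastChar-++ b R (0 ∷ C)) ⟩
  reverseBWT (suc k) (lastChar (0 ∷ C)) ∎
  where
  a = suc (k * 2)
  b = suc k * 2
  R = map suc (reverse (family k))
  Bᴿ = reverse (block a b)

runsFrom-block : ∀ {p a b} → p ≢ b → b ≢ a → runsFrom p (block a b) ≡ 2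
runsFrom-block {p} {a} {b} p≢b b≢a rewrite ≢⇒≡ᵇ-false p≢b | ≡ᵇ-refl b | ≢⇒≡ᵇ-false b≢a = refl

runsFrom-reversedBlockBWT : ∀ {s p a b} → s ≢ p → p ≢ b → b ≢ a → runsFrom s (reversedBlockBWT p a b) ≡ 3
runsFrom-reversedBlockBWT {s} {p} {a} {b} s≢p p≢b b≢a
  rewrite ≢⇒≡ᵇ-false s≢p | ≢⇒≡ᵇ-false p≢b | ≡ᵇ-refl b | ≢⇒≡ᵇ-false b≢a = refl

lastChar-shifted-family-bound : ∀ k → lastChar (0 ∷ map suc (family k)) < suc (k * 2)
lastChar-shifted-family-bound k = lastChar-All (z<s ∷ shifted-family-bound k)

runsFrom-forwardBWT : ∀ k {s} → s ≢ 2 → runsFrom s (forwardBWT (suc k)) ≡ suc k * 2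
runsFrom-forwardBWT zero    s≢2 = runsFrom-block {a = 0} s≢2 (λ ())
runsFrom-forwardBWT (suc k) {s} s≢2 = begin
  runsFrom s (forwardBWT (suc k) ++ block c b)
    ≡⟨ runsFrom-++ s (forwardBWT (suc k)) (block c b) ⟩
  runsFrom s (forwardBWT (suc k)) + runsFrom (lastChar (s ∷ forwardBWT (suc k))) (block c b)
    ≡⟨ cong₂ _+_ (runsFrom-forwardBWT k s≢2)
                 (trans (cong (λ p → runsFrom p (block c b)) (lastChar-++ s (forwardBWT k) _))
                        (runsFrom-block c′≢b b≢c)) ⟩
  suc k * 2 + 2
    ≡⟨ +-comm (suc k * 2) 2 ⟩
  suc (suc k) * 2 ∎
  where
  b = suc (suc k) * 2
  c = lastChar (0 ∷ map suc (family (suc k)))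
  c′≢b : lastChar (0 ∷ map suc (family k)) ≢ b
  c′≢b = <⇒≢ (<-trans (lastChar-shifted-family-bound k) (m<n+m (suc (k * 2)) {3} z<s))
  b≢c : b ≢ c
  b≢c = >⇒≢ (m<n⇒m<1+n (lastChar-shifted-family-bound (suc k)))

≢-zero-or-above : p ≡ 0 ⊎ t < p → 0 < x → x ≤ t → x ≢ p
≢-zero-or-above (inj₁ refl) 0<x _   = >⇒≢ 0<x
≢-zero-or-above (inj₂ t<p)  _   x≤t = <⇒≢ (≤-<-trans x≤t t<p)

-- p, the symbol preceding the top block, is $ or a symbol of a later block.
runsFrom-reverseBWT : ∀ k {p} → p ≡ 0 ⊎ suc k * 2 < p → runsFrom 2 (reverseBWT (suc k) p) ≡ suc k * 3
runsFrom-reverseBWT zero fresh = runsFrom-reversedBlockBWT {a = 1}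
  (≢-zero-or-above fresh z<s ≤-refl) (≢-sym (≢-zero-or-above fresh z<s ≤-refl)) (λ ())
runsFrom-reverseBWT (suc k) {p} fresh = begin
  runsFrom 2 (reverseBWT (suc k) b ++ reversedBlockBWT p a b)
    ≡⟨ runsFrom-++ 2 (reverseBWT (suc k) b) (reversedBlockBWT p a b) ⟩
  runsFrom 2 (reverseBWT (suc k) b) + runsFrom (lastChar (2 ∷ reverseBWT (suc k) b)) (reversedBlockBWT p a b)
    ≡⟨ cong₂ _+_ (runsFrom-reverseBWT k (inj₂ (n≤1+n _)))
                 (trans (cong (λ s → runsFrom s (reversedBlockBWT p a b)) (lastChar-++ 2 (reverseBWT k _) _))
                        (runsFrom-reversedBlockBWT (≢-zero-or-above fresh z<s (m≤n+m _ 3))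
                                                   (≢-sym (≢-zero-or-above fresh z<s ≤-refl))
                                                   (>⇒≢ ≤-refl))) ⟩
  suc k * 3 + 3
    ≡⟨ +-comm (suc k * 3) 3 ⟩
  suc (suc k) * 3 ∎
  where
  a = suc (suc k * 2)
  b = suc (suc k) * 2

r$-family : ∀ k → r$ (family k) ≡ suc (k * 2)
r$-family k = begin
  r$ (family k)                      ≡⟨ cong runs (BWT-dollar (family k)) ⟩
  suc (runsFrom c (map lastChar (sortLex (rotationsIn (map suc (family k)) (0 ∷ [])))))
                                     ≡⟨ cong (suc ∘ runsFrom c) (sortedForward k []) ⟩
  suc (runsFrom c (forwardBWT k))    ≡⟨ runs-forward k ⟩
  suc (k * 2)                        ∎
  where
  c = lastChar (0 ∷ map suc (family k))
  odd≢2 : ∀ k → suc (k * 2) ≢ 2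
  odd≢2 zero    ()
  odd≢2 (suc k) ()
  runs-forward : ∀ k → suc (runsFrom (lastChar (0 ∷ map suc (family k))) (forwardBWT k)) ≡ suc (k * 2)
  runs-forward zero    = refl
  runs-forward (suc k) =
    cong suc (runsFrom-forwardBWT k (subst (_≢ 2) (sym (lastChar-shifted-family k 0)) (odd≢2 k)))

r$-reverse-family : ∀ k → r$ (reverse (family k)) ≡ suc (k * 3)
r$-reverse-family k = begin
  r$ (reverse (family k))            ≡⟨ cong runs (BWT-dollar (reverse (family k))) ⟩
  suc (runsFrom c (map lastChar (sortLex (rotationsIn (map suc (reverse (family k))) (0 ∷ [])))))
                                     ≡⟨ cong (suc ∘ runsFrom c) (sortedReverse k []) ⟩
  suc (runsFrom c (reverseBWT k 0))  ≡⟨ runs-reverse k ⟩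
  suc (k * 3)                        ∎
  where
  c = lastChar (0 ∷ map suc (reverse (family k)))
  runs-reverse : ∀ k → suc (runsFrom (lastChar (0 ∷ map suc (reverse (family k)))) (reverseBWT k 0)) ≡ suc (k * 3)
  runs-reverse zero    = refl
  runs-reverse (suc k) = cong suc (trans (cong (λ s → runsFrom s (reverseBWT (suc k) 0))
                                               (lastChar-shifted-reverse k 0))
                                         (runsFrom-reverseBWT k (inj₁ refl)))

proposition3p5 : (m : ℕ) → Σ (List ℕ) (λ w → (length w ≥ m) × (5 * r$ (reverse w) ≡ 5 * r$ w + length w))
proposition3p5 m = family m , subst (m ≤_) (sym (length-family m)) (m≤m*n m 5) , (begin
  5 * r$ (reverse (family m))            ≡⟨ cong (5 *_) (r$-reverse-family m) ⟩
  5 * suc (m * 3)                        ≡⟨ 5[1+3k]≡5[1+2k]+5k m ⟩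
  5 * suc (m * 2) + m * 5                ≡⟨ sym (cong₂ (λ r n → 5 * r + n) (r$-family m) (length-family m)) ⟩
  5 * r$ (family m) + length (family m)  ∎)
  where
  5[1+3k]≡5[1+2k]+5k : ∀ k → 5 * suc (k * 3) ≡ 5 * suc (k * 2) + k * 5
  5[1+3k]≡5[1+2k]+5k = solve-∀
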